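{- Suppose $1\le n\le m$. Then $G=(V_1,V_2,E)\sim G_{n,m,\frac12}$ contains a complete matching from $V_1$ to $V_2$ with probability $1-2^{ -m(1+o_m(1))}$.
   Context: $G_{n,m,\frac12}$ is a random bipartite graph with colour classes $V_1$, $V_2$ of sizes $n$ and $m$, each of the $nm$ possible edges present independently with probability $1/2$. A complete matching from $V_1$ to $V_2$ is a matching whose edges cover every vertex of $V_1$. -}

module Defs where

open import Data.Nat using (ℕ)
open import Data.Fin using (Fin)
open import Data.Bool using (Bool; true)
open import Data.Vec using (Vec; lookup)
open import Data.Product using (Σ; _×_)
open import Data.Irrelevant using (Irrelevant)
open import Function.Definitions using (Injective)
open import Relation.Binary.PropositionalEquality using (_≡_)
open import Relation.Nullary using (¬_)

-- A bipartite graph with colour classes V₁ = Fin n and V₂ = Fin m,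
-- given by its n × m biadjacency matrix (row i = neighbourhood of i ∈ V₁).
-- The 2^(n*m) such matrices are the equally likely outcomes of G_{n,m,1/2}.
BipGraph : ℕ → ℕ → Set
BipGraph n m = Vec (Vec Bool m) n

Adj : ∀ {n m} → BipGraph n m → Fin n → Fin m → Set
Adj G i j = lookup (lookup G i) j ≡ true

HasCompleteMatching : ∀ {n m} → BipGraph n m → Set
HasCompleteMatching {n} {m} G =
  Σ (Fin n → Fin m) (λ f → Injective _≡_ _≡_ f × (∀ i → Adj G i (f i)))

-- The set of graphs with NO complete matching (proof stored irrelevantly,
-- so that elements are determined by the graph alone).
BadGraph : ℕ → ℕ → Set
BadGraph n m = Σ (BipGraph n m) (λ G → Irrelevant (¬ HasCompleteMatching G))

-- A bipartite graph has no complete matching from V₁ exactly when it has a Hall violator: a zero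
-- block S × T with |S| + |T| > m. This form of Hall's theorem is proved constructively by
-- induction on n: remove a vertex of V₁ together with one of its neighbours j; either the rest
-- has a complete matching, or it has a violator that lifts to a "tight" block avoiding column j,
-- and the tight blocks for all neighbours are merged by the submodular exchange
-- (S ∩ S′, T ∪ T′), (S ∪ S′, T ∩ T′).
--
-- A fixed block S × T is zero in exactly 2^(nm - |S||T|) graphs. A vertex of V₁ without
-- neighbours gives N ≥ 2^(nm - m) bad graphs. Conversely N is at most the sum of 2^(nm - |S||T|)
-- over violating pairs (S, T): if |S| ≤ 3 or |T| ≤ 3 then |S||T| ≥ m and there are only
-- polynomially many such pairs, and otherwise |S||T| ≥ 4m - 12, which pays for all 2^(n+m) pairs.
-- So N·2^m / 2^(nm) is squeezed between 1 and a polynomial in m, which is eventually below 2^(εm).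

module Submission where

open import Defs
open import Data.Nat using (ℕ; zero; suc; _+_; _*_; _^_; _∸_; _≤_; _<_; _≤ᵇ_; _≤?_; _<?_; _/_; _%_; z≤n; s≤s; s≤s⁻¹)
open import Data.Nat.Properties hiding (_≟_; suc-injective; 0≢1+n)
open import Data.Nat.DivMod using (m≡m%n+[m/n]*n; m%n<n; /-monoˡ-≤; m*n/n≡m)
open import Data.Nat.Tactic.RingSolver using (solve-∀)
open import Algebra.Properties.CommutativeSemigroup +-commutativeSemigroup using () renaming (interchange to +-interchange)
open import Algebra.Properties.CommutativeSemigroup *-commutativeSemigroup
  using (x∙yz≈y∙xz; x∙yz≈y∙zx; xy∙z≈zx∙y) renaming (interchange to *-interchange)
open import Data.Bool using (Bool; true; false; not; _∧_)
open import Data.Unit using (tt)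
open import Data.Fin using (Fin; zero; suc; punchIn; punchOut; _≟_)
open import Data.Fin.Properties using (0≢1+n; suc-injective; punchIn-injective; punchInᵢ≢i; punchIn-punchOut; +↔⊎)
open import Data.Fin.Subset using (Subset; inside; outside; _∈_; _∉_; ⊥; ⊤; ⁅_⁆; ∁; _∪_; _∩_; ∣_∣; _-_)
open import Data.Fin.Subset.Properties
  using (∉⊥; ∣⊥∣≡0; ∣⊤∣≡n; ∣⁅x⁆∣≡1; ∣p∣≤n; x∈p∩q⁻; x∈p∪q⁻; x∉p⇒x∈∁p; ∣∁p∣≡n∸∣p∣; x∈p∧x≢y⇒x∈p-y; x∈p⇒∣p-x∣<∣p∣)
open import Data.Vec using (Vec; []; _∷_; here; there; insertAt; lookup)
open import Data.Vec.Properties using (insertAt-lookup; insertAt-punchIn; []=⇒lookup; lookup⇒[]=)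
open import Data.List using (List; []; _∷_; _++_; allFin)
open import Data.List.Membership.Propositional using () renaming (_∈_ to _∈ₗ_)
open import Data.List.Membership.Propositional.Properties using (∈-allFin; ∈-++⁻)
open import Data.List.Relation.Unary.Any using (here; there)
open import Data.Product using (Σ; ∃-syntax; _×_; _,_; proj₁; proj₂)
import Data.Product.Function.Dependent.Propositional as Σ
open import Data.Sum using (_⊎_; inj₁; inj₂)
open import Data.Irrelevant using (Irrelevant; [_])
open import Data.Empty using (⊥-elim-irr)
open import Function using (_∘_)
open import Function.Bundles using (_↔_; mk↔ₛ′)
open import Function.Definitions using (Injective)
open import Function.Properties.Inverse using (↔-refl; ↔-trans)
open import Relation.Binary.PropositionalEquality using (_≡_; _≢_; refl; sym; trans; cong; cong₂; subst; module ≡-Reasoning)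
open import Relation.Nullary using (Dec; yes; no; does; ¬_; contradiction)
open import Relation.Nullary.Decidable using (dec-true; dec-false)

-- Hall's theorem

∣p∪q∣+∣p∩q∣≡∣p∣+∣q∣ : ∀ {k} (p q : Subset k) → ∣ p ∪ q ∣ + ∣ p ∩ q ∣ ≡ ∣ p ∣ + ∣ q ∣
∣p∪q∣+∣p∩q∣≡∣p∣+∣q∣ [] [] = refl
∣p∪q∣+∣p∩q∣≡∣p∣+∣q∣ (inside ∷ p) (inside ∷ q) =
  cong suc (trans (+-suc ∣ p ∪ q ∣ _) (trans (cong suc (∣p∪q∣+∣p∩q∣≡∣p∣+∣q∣ p q)) (sym (+-suc ∣ p ∣ _))))
∣p∪q∣+∣p∩q∣≡∣p∣+∣q∣ (inside ∷ p) (outside ∷ q) = cong suc (∣p∪q∣+∣p∩q∣≡∣p∣+∣q∣ p q)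
∣p∪q∣+∣p∩q∣≡∣p∣+∣q∣ (outside ∷ p) (inside ∷ q) = trans (cong suc (∣p∪q∣+∣p∩q∣≡∣p∣+∣q∣ p q)) (sym (+-suc ∣ p ∣ _))
∣p∪q∣+∣p∩q∣≡∣p∣+∣q∣ (outside ∷ p) (outside ∷ q) = ∣p∪q∣+∣p∩q∣≡∣p∣+∣q∣ p q

∣insertAt-outside∣ : ∀ {k} (p : Subset k) i → ∣ insertAt p i outside ∣ ≡ ∣ p ∣
∣insertAt-outside∣ p zero = refl
∣insertAt-outside∣ (inside ∷ p) (suc i) = cong suc (∣insertAt-outside∣ p i)
∣insertAt-outside∣ (outside ∷ p) (suc i) = ∣insertAt-outside∣ p i

∈-insertAt-outside⁻ : ∀ {k} (p : Subset k) {i j} → j ∈ insertAt p i outside → Σ (i ≢ j) λ i≢j → punchOut i≢j ∈ p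
∈-insertAt-outside⁻ p {i} {j} j∈ with i ≟ j
... | yes refl with () ← trans (sym (insertAt-lookup p i outside)) ([]=⇒lookup j∈)
... | no i≢j = i≢j , lookup⇒[]= _ p (trans (sym (insertAt-punchIn p i outside (punchOut i≢j)))
                                        (trans (cong (lookup (insertAt p i outside)) (punchIn-punchOut i≢j)) ([]=⇒lookup j∈)))

∣p∣≤∣q∣-by-injection : ∀ {k l} (f : Fin k → Fin l) → Injective _≡_ _≡_ f → (p : Subset k) (q : Subset l) →
                       (∀ {x} → x ∈ p → f x ∈ q) → ∣ p ∣ ≤ ∣ q ∣
∣p∣≤∣q∣-by-injection f f-inj [] q f[p]⊆q = z≤n
∣p∣≤∣q∣-by-injection f f-inj (outside ∷ p) q f[p]⊆q =
  ∣p∣≤∣q∣-by-injection (f ∘ suc) (suc-injective ∘ f-inj) p q (f[p]⊆q ∘ there)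
∣p∣≤∣q∣-by-injection f f-inj (inside ∷ p) q f[p]⊆q =
  ≤-trans (s≤s (∣p∣≤∣q∣-by-injection (f ∘ suc) (suc-injective ∘ f-inj) p (q - f zero)
            (λ x∈p → x∈p∧x≢y⇒x∈p-y (f[p]⊆q (there x∈p)) (0≢1+n ∘ sym ∘ f-inj))))
          (x∈p⇒∣p-x∣<∣p∣ (f[p]⊆q here))

-- For a = adj G (defined below) this is HasCompleteMatching G.
Matching : ∀ {n m} → (Fin n → Fin m → Bool) → Set
Matching {n} {m} a = Σ (Fin n → Fin m) λ f → Injective _≡_ _≡_ f × (∀ i → a i (f i) ≡ true)

IsZeroBlock : ∀ {n m} → (Fin n → Fin m → Bool) → Subset n → Subset m → Set
IsZeroBlock a S T = ∀ {i j} → i ∈ S → j ∈ T → a i j ≡ false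

HallViolator : ∀ {n m} → (Fin n → Fin m → Bool) → Set
HallViolator {n} {m} a = ∃[ S ] ∃[ T ] IsZeroBlock a S T × m < ∣ S ∣ + ∣ T ∣

HallViolator⇒¬Matching : ∀ {n m} (a : Fin n → Fin m → Bool) → HallViolator a → ¬ Matching a
HallViolator⇒¬Matching {m = m} a (S , T , S×T-zero , m<∣S∣+∣T∣) (f , f-inj , f-adj) =
  <⇒≱ m<∣S∣+∣T∣ (begin
    ∣ S ∣ + ∣ T ∣       ≤⟨ +-monoˡ-≤ ∣ T ∣ (∣p∣≤∣q∣-by-injection f f-inj S (∁ T) f[S]⊆∁T) ⟩
    ∣ ∁ T ∣ + ∣ T ∣     ≡⟨ cong (_+ ∣ T ∣) (∣∁p∣≡n∸∣p∣ T) ⟩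
    m ∸ ∣ T ∣ + ∣ T ∣   ≡⟨ m∸n+n≡m (∣p∣≤n T) ⟩
    m                   ∎)
  where
  open ≤-Reasoning
  f[S]⊆∁T : ∀ {i} → i ∈ S → f i ∈ ∁ T
  f[S]⊆∁T {i} i∈S = x∉p⇒x∈∁p λ fi∈T → contradiction (trans (sym (f-adj i)) (S×T-zero i∈S fi∈T)) λ ()

zeroBlock-∩∪ : ∀ {n m} {a : Fin n → Fin m → Bool} {S S′ T T′} →
               IsZeroBlock a S T → IsZeroBlock a S′ T′ → IsZeroBlock a (S ∩ S′) (T ∪ T′)
zeroBlock-∩∪ {S = S} {S′} {T} {T′} z z′ i∈S∩S′ j∈T∪T′ with x∈p∩q⁻ S S′ i∈S∩S′ | x∈p∪q⁻ T T′ j∈T∪T′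
... | i∈S , _   | inj₁ j∈T  = z i∈S j∈T
... | _   , i∈S′ | inj₂ j∈T′ = z′ i∈S′ j∈T′

zeroBlock-∪∩ : ∀ {n m} {a : Fin n → Fin m → Bool} {S S′ T T′} →
               IsZeroBlock a S T → IsZeroBlock a S′ T′ → IsZeroBlock a (S ∪ S′) (T ∩ T′)
zeroBlock-∪∩ {S = S} {S′} {T} {T′} z z′ i∈S∪S′ j∈T∩T′ with x∈p∪q⁻ S S′ i∈S∪S′ | x∈p∩q⁻ T T′ j∈T∩T′
... | inj₁ i∈S  | j∈T , _   = z i∈S j∈T
... | inj₂ i∈S′ | _   , j∈T′ = z′ i∈S′ j∈T′

zeroBlock-insertAt : ∀ {n m} {a : Fin n → Fin (suc m) → Bool} {S T} j →
                     IsZeroBlock (λ i k → a i (punchIn j k)) S T → IsZeroBlock a S (insertAt T j outside)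
zeroBlock-insertAt {a = a} {T = T} j z i∈S k∈T′ with ∈-insertAt-outside⁻ T k∈T′
... | j≢k , k′∈T = subst (λ k → a _ k ≡ false) (punchIn-punchOut j≢k) (z i∈S k′∈T)

≥-by-exchange : ∀ {k x y u v} → u + v ≡ x + y → k ≤ x → k ≤ y → u ≤ k → k ≤ v
≥-by-exchange {k} {x} {y} {u} {v} u+v≡x+y k≤x k≤y u≤k =
  +-cancelˡ-≤ k k v (≤-trans (subst (k + k ≤_) (sym u+v≡x+y) (+-mono-≤ k≤x k≤y)) (+-monoˡ-≤ v u≤k))

module HallStep {n m : ℕ} (a : Fin (suc n) → Fin (suc m) → Bool)
                (hall-minor : (b : Fin n → Fin m → Bool) → Matching b ⊎ HallViolator b) where

  minor : Fin (suc m) → Fin n → Fin m → Bool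
  minor j i k = a (suc i) (punchIn j k)

  -- A zero block in the rows other than 0 that becomes a violator when row 0 is added, once its
  -- columns avoid every neighbour of 0.
  record TightBlock (js : List (Fin (suc m))) : Set where
    field
      rows        : Subset n
      cols        : Subset (suc m)
      isZeroBlock : IsZeroBlock (a ∘ suc) rows cols
      tight       : suc m ≤ ∣ rows ∣ + ∣ cols ∣
      avoids      : ∀ {j} → j ∈ₗ js → a zero j ≡ true → j ∉ cols

  open TightBlock

  violator-without-row₀ : ∀ {S T} → IsZeroBlock (a ∘ suc) S T → suc m < ∣ S ∣ + ∣ T ∣ → HallViolator a
  violator-without-row₀ {S} {T} z big = outside ∷ S , T , (λ { (there i∈S) j∈T → z i∈S j∈T }) , big

  -- The sizes of the two exchanged blocks add up to those of B and B′, so if the first is not a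
  -- violator, the second is still tight.
  meet : ∀ {js ks} → TightBlock js → TightBlock ks → HallViolator a ⊎ TightBlock (ks ++ js)
  meet {js} {ks} B B′ with suc m <? ∣ rows B ∩ rows B′ ∣ + ∣ cols B ∪ cols B′ ∣
  ... | yes big = inj₁ (violator-without-row₀ (zeroBlock-∩∪ (isZeroBlock B) (isZeroBlock B′)) big)
  ... | no ¬big = inj₂ record
    { rows        = rows B ∪ rows B′
    ; cols        = cols B ∩ cols B′
    ; isZeroBlock = zeroBlock-∪∩ (isZeroBlock B) (isZeroBlock B′)
    ; tight       = ≥-by-exchange sizes (tight B) (tight B′) (≮⇒≥ ¬big)
    ; avoids      = avoids-∩
    }
    where
    sizes : (∣ rows B ∩ rows B′ ∣ + ∣ cols B ∪ cols B′ ∣) + (∣ rows B ∪ rows B′ ∣ + ∣ cols B ∩ cols B′ ∣)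
          ≡ (∣ rows B ∣ + ∣ cols B ∣) + (∣ rows B′ ∣ + ∣ cols B′ ∣)
    sizes = begin
      (∣ R ∩ R′ ∣ + ∣ C ∪ C′ ∣) + (∣ R ∪ R′ ∣ + ∣ C ∩ C′ ∣) ≡⟨ +-interchange ∣ R ∩ R′ ∣ _ _ _ ⟩
      (∣ R ∩ R′ ∣ + ∣ R ∪ R′ ∣) + (∣ C ∪ C′ ∣ + ∣ C ∩ C′ ∣) ≡⟨ cong₂ _+_ (trans (+-comm ∣ R ∩ R′ ∣ _) (∣p∪q∣+∣p∩q∣≡∣p∣+∣q∣ R R′))
                                                                         (∣p∪q∣+∣p∩q∣≡∣p∣+∣q∣ C C′) ⟩
      (∣ R ∣ + ∣ R′ ∣) + (∣ C ∣ + ∣ C′ ∣)                 ≡⟨ +-interchange ∣ R ∣ _ _ _ ⟩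
      (∣ R ∣ + ∣ C ∣) + (∣ R′ ∣ + ∣ C′ ∣)                 ∎
      where
      open ≡-Reasoning
      R = rows B; R′ = rows B′; C = cols B; C′ = cols B′
    avoids-∩ : ∀ {j} → j ∈ₗ ks ++ js → a zero j ≡ true → j ∉ cols B ∩ cols B′
    avoids-∩ j∈ a₀j j∈∩ with ∈-++⁻ ks j∈ | x∈p∩q⁻ (cols B) (cols B′) j∈∩
    ... | inj₁ j∈ks | _ , j∈T′ = avoids B′ j∈ks a₀j j∈T′
    ... | inj₂ j∈js | j∈T , _  = avoids B j∈js a₀j j∈T

  initial : TightBlock []
  initial = record
    { rows        = ⊥
    ; cols        = ⊤
    ; isZeroBlock = λ i∈⊥ _ → contradiction i∈⊥ ∉⊥
    ; tight       = ≤-reflexive (sym (cong₂ _+_ (∣⊥∣≡0 n) (∣⊤∣≡n (suc m))))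
    ; avoids      = λ ()
    }

  skip : ∀ {js} j → a zero j ≡ false → TightBlock js → TightBlock (j ∷ js)
  skip {js} j a₀j≡false B = record
    { rows = rows B ; cols = cols B ; isZeroBlock = isZeroBlock B ; tight = tight B ; avoids = avoids′ }
    where
    avoids′ : ∀ {k} → k ∈ₗ j ∷ js → a zero k ≡ true → k ∉ cols B
    avoids′ (here refl) a₀j≡true = contradiction (trans (sym a₀j≡false) a₀j≡true) λ ()
    avoids′ (there k∈js) = avoids B k∈js

  fromMinorViolator : ∀ j → HallViolator (minor j) → TightBlock (j ∷ [])
  fromMinorViolator j (S , T , z , m<∣S∣+∣T∣) = record
    { rows        = S
    ; cols        = insertAt T j outside
    ; isZeroBlock = zeroBlock-insertAt j z
    ; tight       = subst (λ t → suc m ≤ ∣ S ∣ + t) (sym (∣insertAt-outside∣ T j)) m<∣S∣+∣T∣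
    ; avoids      = λ { (here refl) _ j∈T′ → proj₁ (∈-insertAt-outside⁻ T j∈T′) refl }
    }

  extend : ∀ j → a zero j ≡ true → Matching (minor j) → Matching a
  extend j a₀j (g , g-inj , g-adj) = f , f-inj , f-adj
    where
    f : Fin (suc n) → Fin (suc m)
    f zero    = j
    f (suc i) = punchIn j (g i)
    f-inj : Injective _≡_ _≡_ f
    f-inj {zero}  {zero}  _  = refl
    f-inj {zero}  {suc y} eq = contradiction (sym eq) (punchInᵢ≢i j (g y))
    f-inj {suc x} {zero}  eq = contradiction eq (punchInᵢ≢i j (g x))
    f-inj {suc x} {suc y} eq = cong suc (g-inj (punchIn-injective j _ _ eq))
    f-adj : ∀ i → a i (f i) ≡ true
    f-adj zero    = a₀j
    f-adj (suc i) = g-adj i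

  close : TightBlock (allFin (suc m)) → HallViolator a
  close B = inside ∷ rows B , cols B , z , s≤s (tight B)
    where
    z : IsZeroBlock a (inside ∷ rows B) (cols B)
    z {zero} {j} here j∈T with a zero j in a₀j
    ... | false = refl
    ... | true  = contradiction j∈T (avoids B (∈-allFin j) a₀j)
    z (there i∈S) j∈T = isZeroBlock B i∈S j∈T

  sweep : ∀ js → Matching a ⊎ HallViolator a ⊎ TightBlock js
  sweep [] = inj₂ (inj₂ initial)
  sweep (j ∷ js) with sweep js
  ... | inj₁ μ          = inj₁ μ
  ... | inj₂ (inj₁ v)   = inj₂ (inj₁ v)
  ... | inj₂ (inj₂ B) with a zero j in a₀j
  ...   | false = inj₂ (inj₂ (skip j a₀j B))
  ...   | true with hall-minor (minor j)
  ...     | inj₁ μ = inj₁ (extend j a₀j μ)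
  ...     | inj₂ v = inj₂ (meet B (fromMinorViolator j v))

  matching-or-violator : Matching a ⊎ HallViolator a
  matching-or-violator with sweep (allFin (suc m))
  ... | inj₁ μ        = inj₁ μ
  ... | inj₂ (inj₁ v) = inj₂ v
  ... | inj₂ (inj₂ B) = inj₂ (close B)

hall : ∀ n m (a : Fin n → Fin m → Bool) → Matching a ⊎ HallViolator a
hall zero    m       a = inj₁ ((λ ()) , (λ {x} → contradiction x λ ()) , λ ())
hall (suc n) zero    a = inj₂ (⁅ zero ⁆ , [] , (λ _ ()) , s≤s z≤n)
hall (suc n) (suc m) a = HallStep.matching-or-violator a (hall n m)

-- Finite sums

SumOver : Set → Set
SumOver A = (A → ℕ) → ℕ

IsCongruent : ∀ {A} → SumOver A → Set
IsCongruent ∑ = ∀ {f g} → (∀ x → f x ≡ g x) → ∑ f ≡ ∑ g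

IsAdditive : ∀ {A} → SumOver A → Set
IsAdditive ∑ = ∀ f g → ∑ (λ x → f x + g x) ≡ ∑ f + ∑ g

record IsSum {A : Set} (∑ : SumOver A) : Set₁ where
  field
    ∑-cong  : IsCongruent ∑
    ∑-+     : IsAdditive ∑
    ∑-mono  : ∀ {f g} → (∀ x → f x ≤ g x) → ∑ f ≤ ∑ g
    ∑-*     : ∀ c f → ∑ (λ x → c * f x) ≡ c * ∑ f
    ≤-∑     : ∀ f x → f x ≤ ∑ f
    Fin-∑↔Σ : ∀ f → Fin (∑ f) ↔ Σ A (Fin ∘ f)
    ∑-swap  : ∀ {B : Set} {∑′ : SumOver B} → IsCongruent ∑′ → IsAdditive ∑′ →
              (f : A → B → ℕ) → ∑ (λ x → ∑′ (f x)) ≡ ∑′ (λ y → ∑ (λ x → f x y))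

∑Bool : SumOver Bool
∑Bool f = f true + f false

⊎↔ΣBool : ∀ (P : Bool → Set) → (P true ⊎ P false) ↔ Σ Bool P
⊎↔ΣBool P = mk↔ₛ′ to from to∘from (λ { (inj₁ _) → refl ; (inj₂ _) → refl })
  where
  to : P true ⊎ P false → Σ Bool P
  to (inj₁ p) = true , p
  to (inj₂ p) = false , p
  from : Σ Bool P → P true ⊎ P false
  from (true , p)  = inj₁ p
  from (false , p) = inj₂ p
  to∘from : ∀ x → to (from x) ≡ x
  to∘from (true , _)  = refl
  to∘from (false , _) = refl

∑Bool-isSum : IsSum ∑Bool
∑Bool-isSum = record
  { ∑-cong  = λ f≡g → cong₂ _+_ (f≡g true) (f≡g false)
  ; ∑-+     = λ f g → +-interchange (f true) (g true) (f false) (g false)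
  ; ∑-mono  = λ f≤g → +-mono-≤ (f≤g true) (f≤g false)
  ; ∑-*     = λ c f → sym (*-distribˡ-+ c (f true) (f false))
  ; ≤-∑     = λ { f true → m≤m+n _ _ ; f false → m≤n+m _ _ }
  ; Fin-∑↔Σ = λ f → ↔-trans +↔⊎ (⊎↔ΣBool (Fin ∘ f))
  ; ∑-swap  = λ _ ∑′-+ f → sym (∑′-+ (f true) (f false))
  }

∑Vec : ∀ {A} → SumOver A → ∀ k → SumOver (Vec A k)
∑Vec ∑ zero    F = F []
∑Vec ∑ (suc k) F = ∑ (λ x → ∑Vec ∑ k (λ v → F (x ∷ v)))

Σ-∷↔ : ∀ {A : Set} {k} (P : Vec A (suc k) → Set) → Σ A (λ x → Σ (Vec A k) (λ v → P (x ∷ v))) ↔ Σ (Vec A (suc k)) P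
Σ-∷↔ P = mk↔ₛ′ (λ { (x , v , p) → x ∷ v , p }) (λ { (x ∷ v , p) → x , v , p }) (λ { (x ∷ v , p) → refl }) (λ { (x , v , p) → refl })

∑Vec-isSum : ∀ {A} {∑ : SumOver A} → IsSum ∑ → ∀ k → IsSum (∑Vec ∑ k)
∑Vec-isSum _ zero = record
  { ∑-cong  = λ f≡g → f≡g []
  ; ∑-+     = λ _ _ → refl
  ; ∑-mono  = λ f≤g → f≤g []
  ; ∑-*     = λ _ _ → refl
  ; ≤-∑     = λ { f [] → ≤-refl }
  ; Fin-∑↔Σ = λ F → mk↔ₛ′ ([] ,_) (λ { ([] , i) → i }) (λ { ([] , _) → refl }) (λ _ → refl)
  ; ∑-swap  = λ ∑′-cong _ _ → ∑′-cong λ _ → refl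
  }
∑Vec-isSum {A} {∑} s (suc k) = record
  { ∑-cong  = λ f≡g → S.∑-cong λ x → V.∑-cong λ v → f≡g (x ∷ v)
  ; ∑-+     = λ f g → trans (S.∑-cong λ x → V.∑-+ _ _) (S.∑-+ _ _)
  ; ∑-mono  = λ f≤g → S.∑-mono λ x → V.∑-mono λ v → f≤g (x ∷ v)
  ; ∑-*     = λ c f → trans (S.∑-cong λ x → V.∑-* c _) (S.∑-* c _)
  ; ≤-∑     = λ { f (x ∷ v) → ≤-trans (V.≤-∑ (λ w → f (x ∷ w)) v) (S.≤-∑ (λ y → ∑Vec ∑ k (λ w → f (y ∷ w))) x) }
  ; Fin-∑↔Σ = λ F → ↔-trans (S.Fin-∑↔Σ _) (↔-trans (Σ.cong ↔-refl (V.Fin-∑↔Σ _)) (Σ-∷↔ (Fin ∘ F)))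
  ; ∑-swap  = λ ∑′-cong ∑′-+ f → trans (S.∑-cong λ x → V.∑-swap ∑′-cong ∑′-+ λ v → f (x ∷ v)) (S.∑-swap ∑′-cong ∑′-+ _)
  }
  where
  module S = IsSum s
  module V = IsSum (∑Vec-isSum s k)

∑-product : ∀ {A B} {∑ : SumOver A} {∑′ : SumOver B} → IsSum ∑ → IsSum ∑′ →
            ∀ (f : A → ℕ) (g : B → ℕ) → ∑ (λ x → ∑′ (λ y → f x * g y)) ≡ ∑ f * ∑′ g
∑-product {∑ = ∑} {∑′} s s′ f g = begin
  ∑ (λ x → ∑′ (λ y → f x * g y)) ≡⟨ S.∑-cong (λ x → trans (S′.∑-* (f x) g) (*-comm (f x) _)) ⟩
  ∑ (λ x → ∑′ g * f x)           ≡⟨ S.∑-* (∑′ g) f ⟩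
  ∑′ g * ∑ f                     ≡⟨ *-comm (∑′ g) _ ⟩
  ∑ f * ∑′ g                     ∎
  where
  open ≡-Reasoning
  module S = IsSum s
  module S′ = IsSum s′

𝟙 : Bool → ℕ
𝟙 true  = 1
𝟙 false = 0

𝟙-∧ : ∀ x y → 𝟙 (x ∧ y) ≡ 𝟙 x * 𝟙 y
𝟙-∧ true  y = sym (+-identityʳ (𝟙 y))
𝟙-∧ false y = refl

∑Sub : ∀ k → SumOver (Subset k)
∑Sub = ∑Vec ∑Bool

∑Sub-isSum : ∀ k → IsSum (∑Sub k)
∑Sub-isSum = ∑Vec-isSum ∑Bool-isSum

∑Sub-const : ∀ k c → ∑Sub k (λ _ → c) ≡ 2 ^ k * c
∑Sub-const zero    c = sym (+-identityʳ c)
∑Sub-const (suc k) c = begin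
  ∑Sub k (λ _ → c) + ∑Sub k (λ _ → c) ≡⟨ cong₂ _+_ (∑Sub-const k c) (∑Sub-const k c) ⟩
  2 ^ k * c + 2 ^ k * c               ≡⟨ cong (2 ^ k * c +_) (sym (+-identityʳ _)) ⟩
  2 * (2 ^ k * c)                     ≡⟨ *-assoc 2 (2 ^ k) c ⟨
  2 ^ suc k * c                       ∎
  where open ≡-Reasoning

∑Sub-∁ : ∀ k (f : Subset k → ℕ) → ∑Sub k (f ∘ ∁) ≡ ∑Sub k f
∑Sub-∁ zero    f = refl
∑Sub-∁ (suc k) f = trans (cong₂ _+_ (∑Sub-∁ k (f ∘ (outside ∷_))) (∑Sub-∁ k (f ∘ (inside ∷_))))
                           (+-comm (∑Sub k (f ∘ (outside ∷_))) _)

≤ᵇ-suc : ∀ m n → (suc m ≤ᵇ suc n) ≡ (m ≤ᵇ n)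
≤ᵇ-suc zero    n = refl
≤ᵇ-suc (suc m) n = refl

∑Sub-small : ∀ k K → ∑Sub k (λ S → 𝟙 (∣ S ∣ ≤ᵇ K)) ≤ suc k ^ K
∑Sub-small zero    K       = ≤-reflexive (sym (^-zeroˡ K))
∑Sub-small (suc k) zero    =
  ≤-trans (≤-reflexive (cong (_+ ∑Sub k (λ S → 𝟙 (∣ S ∣ ≤ᵇ 0))) (trans (∑Sub-const k 0) (*-zeroʳ (2 ^ k)))))
          (∑Sub-small k zero)
∑Sub-small (suc k) (suc K) = begin
  ∑Sub k (λ S → 𝟙 (suc ∣ S ∣ ≤ᵇ suc K)) + ∑Sub k (λ S → 𝟙 (∣ S ∣ ≤ᵇ suc K))
    ≡⟨ cong (_+ ∑Sub k (λ S → 𝟙 (∣ S ∣ ≤ᵇ suc K))) (IsSum.∑-cong (∑Sub-isSum k) λ S → cong 𝟙 (≤ᵇ-suc ∣ S ∣ K)) ⟩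
  ∑Sub k (λ S → 𝟙 (∣ S ∣ ≤ᵇ K)) + ∑Sub k (λ S → 𝟙 (∣ S ∣ ≤ᵇ suc K))
    ≤⟨ +-mono-≤ (∑Sub-small k K) (∑Sub-small k (suc K)) ⟩
  suc (suc k) * suc k ^ K
    ≤⟨ *-monoʳ-≤ (suc (suc k)) (^-monoˡ-≤ K (n≤1+n (suc k))) ⟩
  suc (suc k) ^ suc K
    ∎
  where open ≤-Reasoning

∑Sub-cosmall : ∀ k K → ∑Sub k (λ S → 𝟙 (∣ ∁ S ∣ ≤ᵇ K)) ≤ suc k ^ K
∑Sub-cosmall k K = ≤-trans (≤-reflexive (∑Sub-∁ k (λ S → 𝟙 (∣ S ∣ ≤ᵇ K)))) (∑Sub-small k K)

∑∑ : ∀ n m → (Subset n → Subset m → ℕ) → ℕ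
∑∑ n m f = ∑Sub n (λ S → ∑Sub m (f S))

module _ (n m : ℕ) where
  private
    module ∑n = IsSum (∑Sub-isSum n)
    module ∑m = IsSum (∑Sub-isSum m)

  ∑∑-mono : ∀ {f g} → (∀ S T → f S T ≤ g S T) → ∑∑ n m f ≤ ∑∑ n m g
  ∑∑-mono f≤g = ∑n.∑-mono λ S → ∑m.∑-mono (f≤g S)

  ∑∑-+ : ∀ f g → ∑∑ n m (λ S T → f S T + g S T) ≡ ∑∑ n m f + ∑∑ n m g
  ∑∑-+ f g = trans (∑n.∑-cong λ S → ∑m.∑-+ (f S) (g S)) (∑n.∑-+ _ _)

  ∑∑-* : ∀ c f → ∑∑ n m (λ S T → c * f S T) ≡ c * ∑∑ n m f
  ∑∑-* c f = trans (∑n.∑-cong λ S → ∑m.∑-* c (f S)) (∑n.∑-* c _)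

  ∑∑-const : ∀ c → ∑∑ n m (λ _ _ → c) ≡ 2 ^ (n + m) * c
  ∑∑-const c = begin
    ∑∑ n m (λ _ _ → c)  ≡⟨ ∑n.∑-cong (λ _ → ∑Sub-const m c) ⟩
    ∑Sub n (λ _ → 2 ^ m * c) ≡⟨ ∑Sub-const n (2 ^ m * c) ⟩
    2 ^ n * (2 ^ m * c) ≡⟨ *-assoc (2 ^ n) (2 ^ m) c ⟨
    2 ^ n * 2 ^ m * c   ≡⟨ cong (_* c) (^-distribˡ-+-* 2 n m) ⟨
    2 ^ (n + m) * c     ∎
    where open ≡-Reasoning

-- Counting graphs by zero blocks

adj : ∀ {n m} → BipGraph n m → Fin n → Fin m → Bool
adj G i j = lookup (lookup G i) j

-- Boolean zero-block test, so that graphs with a given zero block can be counted row by row.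
avoidsᵇ : ∀ {m} → Subset m → Vec Bool m → Bool
avoidsᵇ []            []      = true
avoidsᵇ (inside ∷ T)  (x ∷ r) = not x ∧ avoidsᵇ T r
avoidsᵇ (outside ∷ T) (_ ∷ r) = avoidsᵇ T r

isZeroBlockᵇ : ∀ {n m} → Subset n → Subset m → BipGraph n m → Bool
isZeroBlockᵇ []            T []      = true
isZeroBlockᵇ (inside ∷ S)  T (r ∷ G) = avoidsᵇ T r ∧ isZeroBlockᵇ S T G
isZeroBlockᵇ (outside ∷ S) T (_ ∷ G) = isZeroBlockᵇ S T G

avoidsᵇ-sound : ∀ {m} (T : Subset m) r → avoidsᵇ T r ≡ true → ∀ {j} → j ∈ T → lookup r j ≡ false
avoidsᵇ-sound (inside ∷ T)  (false ∷ r) _ here          = refl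
avoidsᵇ-sound (inside ∷ T)  (false ∷ r) e (there j∈T) = avoidsᵇ-sound T r e j∈T
avoidsᵇ-sound (outside ∷ T) (_ ∷ r)     e (there j∈T) = avoidsᵇ-sound T r e j∈T

avoidsᵇ-complete : ∀ {m} (T : Subset m) r → (∀ {j} → j ∈ T → lookup r j ≡ false) → avoidsᵇ T r ≡ true
avoidsᵇ-complete []            []      _ = refl
avoidsᵇ-complete (inside ∷ T)  (x ∷ r) h with refl ← h here = avoidsᵇ-complete T r (h ∘ there)
avoidsᵇ-complete (outside ∷ T) (_ ∷ r) h = avoidsᵇ-complete T r (h ∘ there)

∧-true⁻ : ∀ {x y} → x ∧ y ≡ true → x ≡ true × y ≡ true
∧-true⁻ {true} {true} _ = refl , refl

isZeroBlockᵇ-sound : ∀ {n m} (S : Subset n) (T : Subset m) G → isZeroBlockᵇ S T G ≡ true → IsZeroBlock (adj G) S T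
isZeroBlockᵇ-sound (inside ∷ S) T (r ∷ G) e here        j∈T = avoidsᵇ-sound T r (proj₁ (∧-true⁻ e)) j∈T
isZeroBlockᵇ-sound (inside ∷ S) T (r ∷ G) e (there i∈S) j∈T = isZeroBlockᵇ-sound S T G (proj₂ (∧-true⁻ e)) i∈S j∈T
isZeroBlockᵇ-sound (outside ∷ S) T (_ ∷ G) e (there i∈S) j∈T = isZeroBlockᵇ-sound S T G e i∈S j∈T

isZeroBlockᵇ-complete : ∀ {n m} (S : Subset n) (T : Subset m) G → IsZeroBlock (adj G) S T → isZeroBlockᵇ S T G ≡ true
isZeroBlockᵇ-complete []            T []      _ = refl
isZeroBlockᵇ-complete (inside ∷ S)  T (r ∷ G) z
  rewrite avoidsᵇ-complete T r (z here) = isZeroBlockᵇ-complete S T G (z ∘ there)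
isZeroBlockᵇ-complete (outside ∷ S) T (_ ∷ G) z = isZeroBlockᵇ-complete S T G (z ∘ there)

∑Graph : ∀ n m → SumOver (BipGraph n m)
∑Graph n m = ∑Vec (∑Sub m) n

∑Graph-isSum : ∀ n m → IsSum (∑Graph n m)
∑Graph-isSum n m = ∑Vec-isSum (∑Sub-isSum m) n

avoidsᵇ-count : ∀ m (T : Subset m) → ∑Sub m (𝟙 ∘ avoidsᵇ T) * 2 ^ ∣ T ∣ ≡ 2 ^ m
avoidsᵇ-count zero    []            = refl
avoidsᵇ-count (suc m) (inside ∷ T)  = begin
  (∑Sub m (λ _ → 0) + A) * (2 * 2 ^ ∣ T ∣) ≡⟨ cong (λ z → (z + A) * (2 * 2 ^ ∣ T ∣)) (trans (∑Sub-const m 0) (*-zeroʳ (2 ^ m))) ⟩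
  A * (2 * 2 ^ ∣ T ∣)                     ≡⟨ x∙yz≈y∙xz A 2 _ ⟩
  2 * (A * 2 ^ ∣ T ∣)                     ≡⟨ cong (2 *_) (avoidsᵇ-count m T) ⟩
  2 * 2 ^ m                               ∎
  where
  open ≡-Reasoning
  A = ∑Sub m (𝟙 ∘ avoidsᵇ T)
avoidsᵇ-count (suc m) (outside ∷ T) = begin
  (A + A) * 2 ^ ∣ T ∣                     ≡⟨ cong (λ z → (A + z) * 2 ^ ∣ T ∣) (sym (+-identityʳ A)) ⟩
  (2 * A) * 2 ^ ∣ T ∣                     ≡⟨ *-assoc 2 A _ ⟩
  2 * (A * 2 ^ ∣ T ∣)                     ≡⟨ cong (2 *_) (avoidsᵇ-count m T) ⟩
  2 * 2 ^ m                               ∎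
  where
  open ≡-Reasoning
  A = ∑Sub m (𝟙 ∘ avoidsᵇ T)

zeroBlock-count : ∀ n m (S : Subset n) (T : Subset m) →
                  ∑Graph n m (𝟙 ∘ isZeroBlockᵇ S T) * 2 ^ (∣ S ∣ * ∣ T ∣) ≡ 2 ^ (n * m)
zeroBlock-count zero    m []            T = refl
zeroBlock-count (suc n) m (inside ∷ S)  T = begin
  ∑Sub m (λ r → ∑Graph n m (λ G → 𝟙 (avoidsᵇ T r ∧ isZeroBlockᵇ S T G))) * 2 ^ (∣ T ∣ + ∣ S ∣ * ∣ T ∣)
    ≡⟨ cong₂ _*_ (trans (∑S.∑-cong λ r → ∑G.∑-cong λ G → 𝟙-∧ (avoidsᵇ T r) (isZeroBlockᵇ S T G))
                        (∑-product (∑Sub-isSum m) (∑Graph-isSum n m) (𝟙 ∘ avoidsᵇ T) (𝟙 ∘ isZeroBlockᵇ S T)))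
                 (^-distribˡ-+-* 2 ∣ T ∣ (∣ S ∣ * ∣ T ∣)) ⟩
  (A * Y) * (2 ^ ∣ T ∣ * 2 ^ (∣ S ∣ * ∣ T ∣))
    ≡⟨ *-interchange A Y _ _ ⟩
  (A * 2 ^ ∣ T ∣) * (Y * 2 ^ (∣ S ∣ * ∣ T ∣))
    ≡⟨ cong₂ _*_ (avoidsᵇ-count m T) (zeroBlock-count n m S T) ⟩
  2 ^ m * 2 ^ (n * m)
    ≡⟨ ^-distribˡ-+-* 2 m (n * m) ⟨
  2 ^ (m + n * m)
    ∎
  where
  open ≡-Reasoning
  module ∑S = IsSum (∑Sub-isSum m)
  module ∑G = IsSum (∑Graph-isSum n m)
  A = ∑Sub m (𝟙 ∘ avoidsᵇ T)
  Y = ∑Graph n m (𝟙 ∘ isZeroBlockᵇ S T)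
zeroBlock-count (suc n) m (outside ∷ S) T = begin
  ∑Sub m (λ _ → Y) * 2 ^ (∣ S ∣ * ∣ T ∣) ≡⟨ cong (_* 2 ^ (∣ S ∣ * ∣ T ∣)) (∑Sub-const m Y) ⟩
  (2 ^ m * Y) * 2 ^ (∣ S ∣ * ∣ T ∣)      ≡⟨ *-assoc (2 ^ m) Y _ ⟩
  2 ^ m * (Y * 2 ^ (∣ S ∣ * ∣ T ∣))      ≡⟨ cong (2 ^ m *_) (zeroBlock-count n m S T) ⟩
  2 ^ m * 2 ^ (n * m)                    ≡⟨ ^-distribˡ-+-* 2 m (n * m) ⟨
  2 ^ (m + n * m)                        ∎
  where
  open ≡-Reasoning
  Y = ∑Graph n m (𝟙 ∘ isZeroBlockᵇ S T)

-- Bounds on the number of bad graphs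

isBad? : ∀ {n m} (G : BipGraph n m) → Dec (¬ HasCompleteMatching G)
isBad? {n} {m} G with hall n m (adj G)
... | inj₁ μ = no λ ¬μ → ¬μ μ
... | inj₂ v = yes (HallViolator⇒¬Matching (adj G) v)

badCount : ℕ → ℕ → ℕ
badCount n m = ∑Graph n m (𝟙 ∘ does ∘ isBad?)

Fin-𝟙↔Irrelevant : ∀ {P : Set} (P? : Dec P) → Fin (𝟙 (does P?)) ↔ Irrelevant P
Fin-𝟙↔Irrelevant (yes p)  = mk↔ₛ′ (λ _ → [ p ]) (λ _ → zero) (λ { [ _ ] → refl }) (λ { zero → refl })
Fin-𝟙↔Irrelevant (no ¬p) = mk↔ₛ′ (λ ()) (λ { [ p ] → ⊥-elim-irr (¬p p) }) (λ { [ p ] → ⊥-elim-irr (¬p p) }) (λ ())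

Fin-badCount↔BadGraph : ∀ n m → Fin (badCount n m) ↔ BadGraph n m
Fin-badCount↔BadGraph n m =
  ↔-trans (IsSum.Fin-∑↔Σ (∑Graph-isSum n m) _) (Σ.cong ↔-refl (Fin-𝟙↔Irrelevant (isBad? _)))

zeroBlock⇒bad : ∀ {n m} (S : Subset n) (T : Subset m) G → m < ∣ S ∣ + ∣ T ∣ →
                𝟙 (isZeroBlockᵇ S T G) ≤ 𝟙 (does (isBad? G))
zeroBlock⇒bad S T G m<∣S∣+∣T∣ with isZeroBlockᵇ S T G in S×T-zero | isBad? G
... | false | _       = z≤n
... | true  | yes _   = ≤-refl
... | true  | no ¬bad =
  contradiction (HallViolator⇒¬Matching (adj G) (S , T , isZeroBlockᵇ-sound S T G S×T-zero , m<∣S∣+∣T∣)) ¬bad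

badCount-lower : ∀ {n} m → 1 ≤ n → 2 ^ (n * m) ≤ badCount n m * 2 ^ m
badCount-lower {suc n} m _ = begin
  2 ^ (suc n * m)          ≡⟨ zeroBlock-count (suc n) m S₀ T₀ ⟨
  Z * 2 ^ (∣ S₀ ∣ * ∣ T₀ ∣) ≡⟨ cong (λ k → Z * 2 ^ k) (trans (cong₂ _*_ (∣⁅x⁆∣≡1 (zero {n})) (∣⊤∣≡n m)) (*-identityˡ m)) ⟩
  Z * 2 ^ m                ≤⟨ *-monoˡ-≤ (2 ^ m) (IsSum.∑-mono (∑Graph-isSum (suc n) m) λ G → zeroBlock⇒bad S₀ T₀ G m<∣S₀∣+∣T₀∣) ⟩
  badCount (suc n) m * 2 ^ m ∎
  where
  open ≤-Reasoning
  S₀ : Subset (suc n)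
  S₀ = ⁅ zero ⁆
  T₀ : Subset m
  T₀ = ⊤
  Z = ∑Graph (suc n) m (𝟙 ∘ isZeroBlockᵇ S₀ T₀)
  m<∣S₀∣+∣T₀∣ : m < ∣ S₀ ∣ + ∣ T₀ ∣
  m<∣S₀∣+∣T₀∣ = s≤s (≤-reflexive (sym (cong₂ _+_ (∣⊥∣≡0 n) (∣⊤∣≡n m))))

violatingᵇ : ∀ {n m} → Subset n → Subset m → Bool
violatingᵇ {m = m} S T = suc m ≤ᵇ ∣ S ∣ + ∣ T ∣

𝟙-≤ᵇ : ∀ {m n} → m ≤ n → 𝟙 (m ≤ᵇ n) ≡ 1
𝟙-≤ᵇ {m} {n} m≤n = cong 𝟙 (dec-true (m ≤? n) m≤n)

bad⇒violatingZeroBlock : ∀ {n m} (G : BipGraph n m) →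
  𝟙 (does (isBad? G)) ≤ ∑∑ n m (λ S T → 𝟙 (violatingᵇ S T) * 𝟙 (isZeroBlockᵇ S T G))
bad⇒violatingZeroBlock {n} {m} G with hall n m (adj G)
... | inj₁ _ = z≤n
... | inj₂ (S , T , S×T-zero , m<∣S∣+∣T∣) =
  ≤-trans (≤-reflexive (sym (cong₂ _*_ (𝟙-≤ᵇ m<∣S∣+∣T∣) (cong 𝟙 (isZeroBlockᵇ-complete S T G S×T-zero)))))
    (≤-trans (IsSum.≤-∑ (∑Sub-isSum m) _ T) (IsSum.≤-∑ (∑Sub-isSum n) _ S))

m<n+1+k⇒m∸n≤k : ∀ m n {k} → m < n + suc k → m ∸ n ≤ k
m<n+1+k⇒m∸n≤k m n {k} m<n+1+k = m≤n+o⇒m∸n≤o m n (s≤s⁻¹ (subst (suc m ≤_) (+-suc n k) m<n+1+k))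

m≤a*b : ∀ {m a b} → m < a + b → a ≤ m → b ≤ m → m ≤ a * b
m≤a*b {a = zero}  m<a+b _   b≤m = contradiction b≤m (<⇒≱ m<a+b)
m≤a*b {m} {suc a} {zero} m<a+b a≤m _ = contradiction a≤m (<⇒≱ (subst (m <_) (+-identityʳ (suc a)) m<a+b))
m≤a*b {m} {suc a} {suc b} m<a+b _ _ = begin
  m                 ≤⟨ s≤s⁻¹ m<a+b ⟩
  a + suc b         ≡⟨ +-comm a (suc b) ⟩
  suc b + a         ≤⟨ +-monoʳ-≤ (suc b) (m≤m*n a (suc b)) ⟩
  suc a * suc b     ∎
  where open ≤-Reasoning

4[7+x+y]+xy≡[4+x][4+y]+12 : ∀ x y → 4 * (7 + x + y) + x * y ≡ (4 + x) * (4 + y) + 12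
4[7+x+y]+xy≡[4+x][4+y]+12 = solve-∀

[4+x]+[4+y]≡1+[7+x+y] : ∀ x y → (4 + x) + (4 + y) ≡ suc (7 + x + y)
[4+x]+[4+y]≡1+[7+x+y] = solve-∀

-- (a - 4)(b - 4) ≥ 0
4m≤a*b+12 : ∀ {m a b} → 4 ≤ a → 4 ≤ b → m < a + b → 4 * m ≤ a * b + 12
4m≤a*b+12 {m} {suc (suc (suc (suc x)))} {suc (suc (suc (suc y)))} (s≤s (s≤s (s≤s (s≤s _)))) (s≤s (s≤s (s≤s (s≤s _)))) m<a+b = begin
  4 * m                   ≤⟨ *-monoʳ-≤ 4 (s≤s⁻¹ (subst (suc m ≤_) ([4+x]+[4+y]≡1+[7+x+y] x y) m<a+b)) ⟩
  4 * (7 + x + y)         ≤⟨ m≤m+n _ (x * y) ⟩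
  4 * (7 + x + y) + x * y ≡⟨ 4[7+x+y]+xy≡[4+x][4+y]+12 x y ⟩
  (4 + x) * (4 + y) + 12  ∎
  where open ≤-Reasoning

4*m≡m+[m+m]+m : ∀ m → 4 * m ≡ m + (m + m) + m
4*m≡m+[m+m]+m = solve-∀

zeroBlocks : ∀ {n m} → Subset n → Subset m → ℕ
zeroBlocks {n} {m} S T = ∑Graph n m (𝟙 ∘ isZeroBlockᵇ S T)

zeroBlocks-≤ : ∀ {n m} (S : Subset n) (T : Subset m) {k} → k ≤ ∣ S ∣ * ∣ T ∣ → zeroBlocks S T * 2 ^ k ≤ 2 ^ (n * m)
zeroBlocks-≤ {n} {m} S T k≤∣S∣∣T∣ =
  ≤-trans (*-monoʳ-≤ (zeroBlocks S T) (^-monoʳ-≤ 2 k≤∣S∣∣T∣)) (≤-reflexive (zeroBlock-count n m S T))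

fewRows : ∀ {n m} → Subset n → Subset m → ℕ
fewRows S T = 𝟙 (∣ S ∣ ≤ᵇ 3) * 𝟙 (∣ ∁ T ∣ ≤ᵇ 2)

fewCols : ∀ {n m} → Subset n → Subset m → ℕ
fewCols S T = 𝟙 (∣ ∁ S ∣ ≤ᵇ 2) * 𝟙 (∣ T ∣ ≤ᵇ 3)

module _ {n m : ℕ} (n≤m : n ≤ m) (S : Subset n) (T : Subset m) (m<∣S∣+∣T∣ : m < ∣ S ∣ + ∣ T ∣) where

  private
    E = 2 ^ (n * m)
    P = 2 ^ (n + m)
    Z = zeroBlocks S T

    ∣S∣≤m : ∣ S ∣ ≤ m
    ∣S∣≤m = ≤-trans (∣p∣≤n S) n≤m

    [2^m*P]*Z≤E*P : (2 ^ m * P) * Z ≤ E * P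
    [2^m*P]*Z≤E*P = begin
      (2 ^ m * P) * Z ≡⟨ *-comm (2 ^ m * P) Z ⟩
      Z * (2 ^ m * P) ≡⟨ *-assoc Z (2 ^ m) P ⟨
      (Z * 2 ^ m) * P ≤⟨ *-monoˡ-≤ P (zeroBlocks-≤ S T (m≤a*b m<∣S∣+∣T∣ ∣S∣≤m (∣p∣≤n T))) ⟩
      E * P           ∎
      where open ≤-Reasoning

    fewRows≡1 : ∣ S ∣ ≤ 3 → fewRows S T ≡ 1
    fewRows≡1 ∣S∣≤3 = cong₂ _*_ (𝟙-≤ᵇ ∣S∣≤3) (𝟙-≤ᵇ (subst (_≤ 2) (sym (∣∁p∣≡n∸∣p∣ T))
                        (m<n+1+k⇒m∸n≤k m ∣ T ∣ (≤-trans m<∣S∣+∣T∣ (≤-trans (+-monoˡ-≤ ∣ T ∣ ∣S∣≤3) (≤-reflexive (+-comm 3 ∣ T ∣)))))))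

    fewCols≡1 : ∣ T ∣ ≤ 3 → fewCols S T ≡ 1
    fewCols≡1 ∣T∣≤3 = cong₂ _*_ (𝟙-≤ᵇ (subst (_≤ 2) (sym (∣∁p∣≡n∸∣p∣ S))
                        (≤-trans (∸-monoˡ-≤ ∣ S ∣ n≤m) (m<n+1+k⇒m∸n≤k m ∣ S ∣ (≤-trans m<∣S∣+∣T∣ (+-monoʳ-≤ ∣ S ∣ ∣T∣≤3)))))) (𝟙-≤ᵇ ∣T∣≤3)

    -- The factor 2^(n+m) pays for summing this case over all pairs (S, T).
    [2^m*P]*Z≤E*2¹² : 4 ≤ ∣ S ∣ → 4 ≤ ∣ T ∣ → (2 ^ m * P) * Z ≤ E * 2 ^ 12
    [2^m*P]*Z≤E*2¹² 4≤∣S∣ 4≤∣T∣ = begin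
      (2 ^ m * P) * Z                 ≡⟨ cong (_* Z) (^-distribˡ-+-* 2 m (n + m)) ⟨
      2 ^ (m + (n + m)) * Z           ≤⟨ *-monoˡ-≤ Z (^-monoʳ-≤ 2 exponent≤) ⟩
      2 ^ (∣ S ∣ * ∣ T ∣ + 12) * Z    ≡⟨ cong (_* Z) (^-distribˡ-+-* 2 (∣ S ∣ * ∣ T ∣) 12) ⟩
      (2 ^ (∣ S ∣ * ∣ T ∣) * 2 ^ 12) * Z ≡⟨ xy∙z≈zx∙y (2 ^ (∣ S ∣ * ∣ T ∣)) (2 ^ 12) Z ⟩
      (Z * 2 ^ (∣ S ∣ * ∣ T ∣)) * 2 ^ 12 ≡⟨ cong (_* 2 ^ 12) (zeroBlock-count n m S T) ⟩
      E * 2 ^ 12                      ∎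
      where
      open ≤-Reasoning
      exponent≤ : m + (n + m) ≤ ∣ S ∣ * ∣ T ∣ + 12
      exponent≤ = begin
        m + (n + m)     ≤⟨ +-monoʳ-≤ m (+-monoˡ-≤ m n≤m) ⟩
        m + (m + m)     ≤⟨ m≤m+n (m + (m + m)) m ⟩
        m + (m + m) + m ≡⟨ 4*m≡m+[m+m]+m m ⟨
        4 * m           ≤⟨ 4m≤a*b+12 4≤∣S∣ 4≤∣T∣ m<∣S∣+∣T∣ ⟩
        ∣ S ∣ * ∣ T ∣ + 12 ∎

    E*P≤ : ∀ {x} c → 1 ≤ x → E * P ≤ E * (P * x + c)
    E*P≤ {x} c 1≤x = *-monoʳ-≤ E (≤-trans (≤-trans (≤-reflexive (sym (*-identityʳ P))) (*-monoʳ-≤ P 1≤x)) (m≤m+n (P * x) c))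

  violatingZeroBlocks-≤ : (2 ^ m * 2 ^ (n + m)) * zeroBlocks S T ≤ 2 ^ (n * m) * (2 ^ (n + m) * (fewRows S T + fewCols S T) + 2 ^ 12)
  violatingZeroBlocks-≤ with ∣ S ∣ ≤? 3 | ∣ T ∣ ≤? 3
  ... | yes ∣S∣≤3 | _         = ≤-trans [2^m*P]*Z≤E*P (E*P≤ (2 ^ 12) (≤-trans (≤-reflexive (sym (fewRows≡1 ∣S∣≤3))) (m≤m+n _ _)))
  ... | no _      | yes ∣T∣≤3 = ≤-trans [2^m*P]*Z≤E*P (E*P≤ (2 ^ 12) (≤-trans (≤-reflexive (sym (fewCols≡1 ∣T∣≤3))) (m≤n+m _ _)))
  ... | no ∣S∣≰3  | no ∣T∣≰3  = ≤-trans ([2^m*P]*Z≤E*2¹² (≰⇒> ∣S∣≰3) (≰⇒> ∣T∣≰3)) (*-monoʳ-≤ E (m≤n+m (2 ^ 12) _))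

violatingᵇ-zeroBlocks-≤ : ∀ {n m} → n ≤ m → (S : Subset n) (T : Subset m) →
  (2 ^ m * 2 ^ (n + m)) * (𝟙 (violatingᵇ S T) * zeroBlocks S T)
    ≤ 2 ^ (n * m) * (2 ^ (n + m) * (fewRows S T + fewCols S T) + 2 ^ 12)
violatingᵇ-zeroBlocks-≤ {n} {m} n≤m S T with suc m ≤? ∣ S ∣ + ∣ T ∣
... | yes v = ≤-trans (≤-reflexive (cong (K *_) (trans (cong (_* zeroBlocks S T) (𝟙-≤ᵇ v)) (*-identityˡ _))))
                      (violatingZeroBlocks-≤ n≤m S T v)
  where K = 2 ^ m * 2 ^ (n + m)
... | no ¬v = ≤-trans (≤-reflexive (trans (cong (λ b → K * (𝟙 b * zeroBlocks S T)) (dec-false (suc m ≤? ∣ S ∣ + ∣ T ∣) ¬v))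
                                          (*-zeroʳ K))) z≤n
  where K = 2 ^ m * 2 ^ (n + m)

∑∑-fewRows : ∀ {n m} → n ≤ m → ∑∑ n m fewRows ≤ suc m ^ 5
∑∑-fewRows {n} {m} n≤m = begin
  ∑∑ n m fewRows                                                      ≡⟨ ∑-product (∑Sub-isSum n) (∑Sub-isSum m) _ _ ⟩
  ∑Sub n (λ S → 𝟙 (∣ S ∣ ≤ᵇ 3)) * ∑Sub m (λ T → 𝟙 (∣ ∁ T ∣ ≤ᵇ 2)) ≤⟨ *-mono-≤ (∑Sub-small n 3) (∑Sub-cosmall m 2) ⟩
  suc n ^ 3 * suc m ^ 2                                               ≤⟨ *-monoˡ-≤ (suc m ^ 2) (^-monoˡ-≤ 3 (s≤s n≤m)) ⟩
  suc m ^ 3 * suc m ^ 2                                               ≡⟨ ^-distribˡ-+-* (suc m) 3 2 ⟨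
  suc m ^ 5                                                           ∎
  where open ≤-Reasoning

∑∑-fewCols : ∀ {n m} → n ≤ m → ∑∑ n m fewCols ≤ suc m ^ 5
∑∑-fewCols {n} {m} n≤m = begin
  ∑∑ n m fewCols                                                      ≡⟨ ∑-product (∑Sub-isSum n) (∑Sub-isSum m) _ _ ⟩
  ∑Sub n (λ S → 𝟙 (∣ ∁ S ∣ ≤ᵇ 2)) * ∑Sub m (λ T → 𝟙 (∣ T ∣ ≤ᵇ 3)) ≤⟨ *-mono-≤ (∑Sub-cosmall n 2) (∑Sub-small m 3) ⟩
  suc n ^ 2 * suc m ^ 3                                               ≤⟨ *-monoˡ-≤ (suc m ^ 3) (^-monoˡ-≤ 2 (s≤s n≤m)) ⟩
  suc m ^ 2 * suc m ^ 3                                               ≡⟨ ^-distribˡ-+-* (suc m) 2 3 ⟨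
  suc m ^ 5                                                           ∎
  where open ≤-Reasoning

∑Graph-∑∑-swap : ∀ n m (f : Subset n → Subset m → ℕ) (g : Subset n → Subset m → BipGraph n m → ℕ) →
  ∑Graph n m (λ G → ∑∑ n m (λ S T → f S T * g S T G)) ≡ ∑∑ n m (λ S T → f S T * ∑Graph n m (g S T))
∑Graph-∑∑-swap n m f g =
  trans (∑G.∑-swap ∑n.∑-cong ∑n.∑-+ _)
        (∑n.∑-cong λ S → trans (∑G.∑-swap ∑m.∑-cong ∑m.∑-+ _) (∑m.∑-cong λ T → ∑G.∑-* (f S T) (g S T)))
  where
  module ∑G = IsSum (∑Graph-isSum n m)
  module ∑n = IsSum (∑Sub-isSum n)
  module ∑m = IsSum (∑Sub-isSum m)

E[P[y+y]+Pc]≡P[[2y+c]E] : ∀ E P y c → E * (P * (y + y) + P * c) ≡ P * ((2 * y + c) * E)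
E[P[y+y]+Pc]≡P[[2y+c]E] = solve-∀

badCount-upper : ∀ {n m} → n ≤ m → badCount n m * 2 ^ m ≤ (2 * suc m ^ 5 + 2 ^ 12) * 2 ^ (n * m)
badCount-upper {n} {m} n≤m = *-cancelˡ-≤ P {{m^n≢0 2 (n + m)}} (begin
  P * (N * 2 ^ m)
    ≡⟨ x∙yz≈y∙zx P N (2 ^ m) ⟩
  N * (2 ^ m * P)
    ≡⟨ *-comm N K ⟩
  K * N
    ≤⟨ *-monoʳ-≤ K (IsSum.∑-mono (∑Graph-isSum n m) bad⇒violatingZeroBlock) ⟩
  K * ∑Graph n m (λ G → ∑∑ n m (λ S T → 𝟙 (violatingᵇ S T) * 𝟙 (isZeroBlockᵇ S T G)))
    ≡⟨ cong (K *_) (∑Graph-∑∑-swap n m (λ S T → 𝟙 (violatingᵇ S T)) (λ S T → 𝟙 ∘ isZeroBlockᵇ S T)) ⟩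
  K * ∑∑ n m (λ S T → 𝟙 (violatingᵇ S T) * zeroBlocks S T)
    ≡⟨ ∑∑-* n m K _ ⟨
  ∑∑ n m (λ S T → K * (𝟙 (violatingᵇ S T) * zeroBlocks S T))
    ≤⟨ ∑∑-mono n m (violatingᵇ-zeroBlocks-≤ n≤m) ⟩
  ∑∑ n m (λ S T → E * (P * (fewRows S T + fewCols S T) + 2 ^ 12))
    ≡⟨ trans (∑∑-* n m E _) (cong (E *_) (trans (∑∑-+ n m _ _)
         (cong₂ _+_ (trans (∑∑-* n m P _) (cong (P *_) (∑∑-+ n m fewRows fewCols))) (∑∑-const n m (2 ^ 12))))) ⟩
  E * (P * (∑∑ n m fewRows + ∑∑ n m fewCols) + P * 2 ^ 12)
    ≤⟨ *-monoʳ-≤ E (+-monoˡ-≤ (P * 2 ^ 12) (*-monoʳ-≤ P (+-mono-≤ (∑∑-fewRows n≤m) (∑∑-fewCols n≤m)))) ⟩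
  E * (P * (suc m ^ 5 + suc m ^ 5) + P * 2 ^ 12)
    ≡⟨ E[P[y+y]+Pc]≡P[[2y+c]E] E P (suc m ^ 5) (2 ^ 12) ⟩
  P * ((2 * suc m ^ 5 + 2 ^ 12) * E)
    ∎)
  where
  open ≤-Reasoning
  N = badCount n m
  E = 2 ^ (n * m)
  P = 2 ^ (n + m)
  K = 2 ^ m * P

-- Polynomial against exponential growth

^-distribʳ-* : ∀ x y k → (x * y) ^ k ≡ x ^ k * y ^ k
^-distribʳ-* x y zero    = refl
^-distribʳ-* x y (suc k) = trans (cong ((x * y) *_) (^-distribʳ-* x y k)) (*-interchange x y (x ^ k) (y ^ k))

[8+u]²+[u²+12u+34]≡2[7+u]² : ∀ u → (8 + u) * (8 + u) + (u * u + 12 * u + 34) ≡ 2 * ((7 + u) * (7 + u))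
[8+u]²+[u²+12u+34]≡2[7+u]² = solve-∀

[7+u]²≤2^[6+u] : ∀ u → (7 + u) * (7 + u) ≤ 2 ^ (6 + u)
[7+u]²≤2^[6+u] zero    = ≤ᵇ⇒≤ 49 64 tt
[7+u]²≤2^[6+u] (suc u) =
  ≤-trans (subst ((8 + u) * (8 + u) ≤_) ([8+u]²+[u²+12u+34]≡2[7+u]² u) (m≤m+n _ _)) (*-monoʳ-≤ 2 ([7+u]²≤2^[6+u] u))

[1+t]²≤2^t : ∀ {t} → 6 ≤ t → suc t * suc t ≤ 2 ^ t
[1+t]²≤2^t (s≤s (s≤s (s≤s (s≤s (s≤s (s≤s {n = u} z≤n)))))) = [7+u]²≤2^[6+u] u

-- With t = ⌊m / k⌋ ≥ k + 6: (m + 1)^k ≤ ((t + 1) k)^k ≤ ((t + 1)^2)^k ≤ 2^(t k) ≤ 2^m.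
[1+m]^k≤2^m-eventually : ∀ k → ∃[ M ] (∀ m → M ≤ m → suc m ^ k ≤ 2 ^ m)
[1+m]^k≤2^m-eventually zero    = 0 , λ m _ → m^n>0 2 m
[1+m]^k≤2^m-eventually (suc K) = (6 + k) * k , bound
  where
  k = suc K
  bound : ∀ m → (6 + k) * k ≤ m → suc m ^ k ≤ 2 ^ m
  bound m M≤m = begin
    suc m ^ k       ≤⟨ ^-monoˡ-≤ k 1+m≤2^t ⟩
    (2 ^ t) ^ k     ≡⟨ ^-*-assoc 2 t k ⟩
    2 ^ (t * k)     ≤⟨ ^-monoʳ-≤ 2 (subst (t * k ≤_) (sym m≡r+tk) (m≤n+m (t * k) r)) ⟩
    2 ^ m           ∎
    where
    open ≤-Reasoning
    t = m / k
    r = m % k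
    m≡r+tk : m ≡ r + t * k
    m≡r+tk = m≡m%n+[m/n]*n m k
    6+k≤t : 6 + k ≤ t
    6+k≤t = subst (_≤ t) (m*n/n≡m (6 + k) k) (/-monoˡ-≤ k M≤m)
    1+m≤2^t : suc m ≤ 2 ^ t
    1+m≤2^t = begin
      suc m         ≡⟨ cong suc m≡r+tk ⟩
      suc r + t * k ≤⟨ +-monoˡ-≤ (t * k) (m%n<n m k) ⟩
      suc t * k     ≤⟨ *-monoʳ-≤ (suc t) (≤-trans (m≤n+m k 6) (≤-trans 6+k≤t (n≤1+n t))) ⟩
      suc t * suc t ≤⟨ [1+t]²≤2^t (≤-trans (m≤m+n 6 k) 6+k≤t) ⟩
      2 ^ t         ∎

[1+z]*8192≡[2[1+z]+4096]+[8190z+4094] : ∀ z → suc z * 8192 ≡ (2 * suc z + 4096) + (z * 8190 + 4094)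
[1+z]*8192≡[2[1+z]+4096]+[8190z+4094] = solve-∀

2y+2¹²≤y*2¹³ : ∀ {y} → 1 ≤ y → 2 * y + 2 ^ 12 ≤ y * 2 ^ 13
2y+2¹²≤y*2¹³ {suc z} _ = subst (2 * suc z + 4096 ≤_) (sym ([1+z]*8192≡[2[1+z]+4096]+[8190z+4094] z)) (m≤m+n _ _)

2[1+m]⁵+2¹²≤[1+m]¹⁸ : ∀ {m} → 1 ≤ m → 2 * suc m ^ 5 + 2 ^ 12 ≤ suc m ^ 18
2[1+m]⁵+2¹²≤[1+m]¹⁸ {m} 1≤m = begin
  2 * suc m ^ 5 + 2 ^ 12 ≤⟨ 2y+2¹²≤y*2¹³ {suc m ^ 5} (m^n>0 (suc m) 5) ⟩
  suc m ^ 5 * 2 ^ 13     ≤⟨ *-monoʳ-≤ (suc m ^ 5) (^-monoˡ-≤ 13 (s≤s 1≤m)) ⟩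
  suc m ^ 5 * suc m ^ 13 ≡⟨ ^-distribˡ-+-* (suc m) 5 13 ⟨
  suc m ^ 18             ∎
  where open ≤-Reasoning

[2[1+m]⁵+2¹²]^q≤2^m-eventually : ∀ q → ∃[ M ] (∀ m → M ≤ m → 1 ≤ m → (2 * suc m ^ 5 + 2 ^ 12) ^ q ≤ 2 ^ m)
[2[1+m]⁵+2¹²]^q≤2^m-eventually q = M , λ m M≤m 1≤m → begin
  (2 * suc m ^ 5 + 2 ^ 12) ^ q ≤⟨ ^-monoˡ-≤ q (2[1+m]⁵+2¹²≤[1+m]¹⁸ 1≤m) ⟩
  (suc m ^ 18) ^ q             ≡⟨ ^-*-assoc (suc m) 18 q ⟩
  suc m ^ (18 * q)             ≤⟨ proj₂ ([1+m]^k≤2^m-eventually (18 * q)) m M≤m ⟩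
  2 ^ m                        ∎
  where
  open ≤-Reasoning
  M = proj₁ ([1+m]^k≤2^m-eventually (18 * q))

^-lowerBound : ∀ {N} a b q r → 2 ^ a ≤ N * 2 ^ b → 2 ^ (q * a) ≤ N ^ q * 2 ^ (b * (q + r))
^-lowerBound {N} a b q r 2^a≤N*2^b = begin
  2 ^ (q * a)           ≡⟨ trans (^-*-assoc 2 a q) (cong (2 ^_) (*-comm a q)) ⟨
  (2 ^ a) ^ q           ≤⟨ ^-monoˡ-≤ q 2^a≤N*2^b ⟩
  (N * 2 ^ b) ^ q       ≡⟨ trans (^-distribʳ-* N (2 ^ b) q) (cong (N ^ q *_) (^-*-assoc 2 b q)) ⟩
  N ^ q * 2 ^ (b * q)   ≤⟨ *-monoʳ-≤ (N ^ q) (^-monoʳ-≤ 2 (*-monoʳ-≤ b (m≤m+n q r))) ⟩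
  N ^ q * 2 ^ (b * (q + r)) ∎
  where open ≤-Reasoning

^-upperBound : ∀ {N c} a b q r → N * 2 ^ b ≤ c * 2 ^ a → c ^ q ≤ 2 ^ (b * r) → N ^ q * 2 ^ (b * q) ≤ 2 ^ (q * a + b * r)
^-upperBound {N} {c} a b q r N*2^b≤c*2^a c^q≤2^br = begin
  N ^ q * 2 ^ (b * q)         ≡⟨ trans (^-distribʳ-* N (2 ^ b) q) (cong (N ^ q *_) (^-*-assoc 2 b q)) ⟨
  (N * 2 ^ b) ^ q             ≤⟨ ^-monoˡ-≤ q N*2^b≤c*2^a ⟩
  (c * 2 ^ a) ^ q             ≡⟨ ^-distribʳ-* c (2 ^ a) q ⟩
  c ^ q * (2 ^ a) ^ q         ≤⟨ *-monoˡ-≤ ((2 ^ a) ^ q) c^q≤2^br ⟩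
  2 ^ (b * r) * (2 ^ a) ^ q   ≡⟨ cong (2 ^ (b * r) *_) (trans (^-*-assoc 2 a q) (cong (2 ^_) (*-comm a q))) ⟩
  2 ^ (b * r) * 2 ^ (q * a)   ≡⟨ ^-distribˡ-+-* 2 (b * r) (q * a) ⟨
  2 ^ (b * r + q * a)         ≡⟨ cong (2 ^_) (+-comm (b * r) (q * a)) ⟩
  2 ^ (q * a + b * r)         ∎
  where open ≤-Reasoning

lemma15 : (p q : ℕ) → 0 < p → 0 < q →
  ∃[ M ] ((m n : ℕ) → M ≤ m → 1 ≤ n → n ≤ m →
    ∃[ N ] ((Fin N ↔ BadGraph n m)
      × (2 ^ (q * (n * m)) ≤ N ^ q * 2 ^ (m * (q + p)))
      × (N ^ q * 2 ^ (m * q) ≤ 2 ^ (q * (n * m) + m * p))))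
lemma15 p@(suc _) q _ _ =
  let M , factor^q≤2^m = [2[1+m]⁵+2¹²]^q≤2^m-eventually q in
  M , λ m n M≤m 1≤n n≤m →
    badCount n m ,
    Fin-badCount↔BadGraph n m ,
    ^-lowerBound (n * m) m q p (badCount-lower m 1≤n) ,
    ^-upperBound (n * m) m q p (badCount-upper n≤m) (≤-trans (factor^q≤2^m m M≤m (≤-trans 1≤n n≤m)) (^-monoʳ-≤ 2 (m≤m*n m p)))
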